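{- Let $S$ be a nonempty set and let $\theta \subseteq \mathcal P(S) \times \mathcal P(S)$. Then $\theta$ is a transition system over $S$ if and only if there exists a decision game $\Gamma = (S, E, O)$ such that for all $X, Y \subseteq S$, \[ (X, Y) \in \theta \iff \Gamma : X \rightarrow Y. \]
   Context: A transition system over a nonempty set $S$ of states is a nonempty relation $\theta \subseteq \mathcal P(S) \times \mathcal P(S)$ such that: (Downwards closure) if $(X,Y)\in\theta$ and $X' \subseteq X$ then $(X',Y)\in\theta$; (Monotonicity) if $(X,Y)\in\theta$ and $Y \subseteq Y'$ then $(X,Y')\in\theta$; (Non-creation) $(\emptyset, Y)\in\theta$ for all $Y\subseteq S$; (Non-triviality) if $X\neq\emptyset$ then $(X,\emptyset)\notin\theta$. A decision game is a triple $\Gamma=(S,E,O)$ where $S$ is a nonempty set of states, $E$ is a nonempty set of decisions, and $O : S\times E \to \mathcal P(S)$ is an outcome function. For $X,Y\subseteq S$, we write $\Gamma : X\rightarrow Y$ ("$\Gamma$ allows the transition from $X$ to $Y$") iff there exists $e\in E$ such that $\emptyset \neq O(s,e)\subseteq Y$ for all $s\in X$. -}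

module Defs where

open import Level using (0ℓ)
open import Data.Product using (Σ; ∃; ∃₂; _×_; _,_)
open import Relation.Nullary using (¬_)
open import Relation.Unary using (Pred; _⊆_; ∅; Empty)

Subset : Set → Set₁
Subset S = Pred S 0ℓ

Rel𝒫 : Set → Set₁
Rel𝒫 S = Subset S → Subset S → Set

-- "X ≠ ∅", read literally: X is not the empty set (no element belongs to X).
_≢∅ : {S : Set} → Subset S → Set
X ≢∅ = ¬ Empty X

record IsTransitionSystem {S : Set} (θ : Rel𝒫 S) : Set₁ where
  field
    nonempty       : ∃₂ λ X Y → θ X Y
    downwardClosed : ∀ {X X′ Y} → θ X Y → X′ ⊆ X → θ X′ Y
    monotone       : ∀ {X Y Y′} → θ X Y → Y ⊆ Y′ → θ X Y′
    nonCreation    : ∀ Y → θ ∅ Y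
    nonTriviality  : ∀ {X} → X ≢∅ → ¬ θ X ∅

-- Decision game Γ = (S, E, O) on a fixed state set S: a nonempty set E of
-- decisions (given by an inhabitant) and an outcome function O : S × E → P(S).
record DecisionGame (S : Set) : Set₂ where
  field
    E  : Set₁
    e₀ : E
    O  : S → E → Subset S

Allows : {S : Set} → DecisionGame S → Subset S → Subset S → Set₁
Allows Γ X Y = Σ E λ e → ∀ s → X s → (O s e ≢∅) × (O s e ⊆ Y)
  where open DecisionGame Γ

-- Every decision game induces a transition system: the four axioms are immediate from the
-- shape of Allows.  Conversely θ is realised by its canonical game, whose decisions are the
-- pairs (X′, Y′) ∈ θ, decision (X′, Y′) sending each state of X′ to all of Y′ and every other
-- state nowhere.  A decision (X′, Y′) admissible from a nonempty X forces X ⊆ X′ and Y′ ⊆ Y,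
-- so (X, Y) ∈ θ by downward closure and monotonicity; from the empty set, non-creation applies.
module Submission where

open import Defs
open import Level using (0ℓ)
open import Data.Product using (Σ; ∃; _×_; _,_; proj₁; proj₂)
open import Axiom.ExcludedMiddle using (ExcludedMiddle)
open import Relation.Nullary using (¬_; yes; no)
open import Relation.Unary using (∅; _⊆_)
open import Data.Empty using (⊥-elim)

Represents : {S : Set} → DecisionGame S → Rel𝒫 S → Set₁
Represents Γ θ = ∀ X Y → (θ X Y → Allows Γ X Y) × (Allows Γ X Y → θ X Y)

module _ {S : Set} (Γ : DecisionGame S) where
  open DecisionGame Γ

  allows-∅ : ∀ Y → Allows Γ ∅ Y
  allows-∅ Y = e₀ , λ _ ()

  allows-downwardClosed : ∀ {X X′ Y} → Allows Γ X Y → X′ ⊆ X → Allows Γ X′ Y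
  allows-downwardClosed (e , h) X′⊆X = e , λ s s∈X′ → h s (X′⊆X s∈X′)

  allows-monotone : ∀ {X Y Y′} → Allows Γ X Y → Y ⊆ Y′ → Allows Γ X Y′
  allows-monotone (e , h) Y⊆Y′ =
    e , λ s s∈X → proj₁ (h s s∈X) , λ t∈O → Y⊆Y′ (proj₂ (h s s∈X) t∈O)

  ¬allows-to-∅ : ∀ {X} → X ≢∅ → ¬ Allows Γ X ∅
  ¬allows-to-∅ X≢∅ (e , h) = X≢∅ λ s s∈X → proj₁ (h s s∈X) λ t t∈O → proj₂ (h s s∈X) t∈O

represented⇒isTransitionSystem : {S : Set} {θ : Rel𝒫 S} (Γ : DecisionGame S) →
                                 Represents Γ θ → IsTransitionSystem θ
represented⇒isTransitionSystem {θ = θ} Γ rep = record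
  { nonempty       = ∅ , ∅ , nonCreation ∅
  ; downwardClosed = λ p X′⊆X → fromAllows (allows-downwardClosed Γ (toAllows p) X′⊆X)
  ; monotone       = λ p Y⊆Y′ → fromAllows (allows-monotone Γ (toAllows p) Y⊆Y′)
  ; nonCreation    = nonCreation
  ; nonTriviality  = λ X≢∅ p → ¬allows-to-∅ Γ X≢∅ (toAllows p)
  }
  where
  toAllows : ∀ {X Y} → θ X Y → Allows Γ X Y
  toAllows = proj₁ (rep _ _)

  fromAllows : ∀ {X Y} → Allows Γ X Y → θ X Y
  fromAllows = proj₂ (rep _ _)

  nonCreation : ∀ Y → θ ∅ Y
  nonCreation Y = fromAllows (allows-∅ Γ Y)

module CanonicalGame {S : Set} {θ : Rel𝒫 S} (ts : IsTransitionSystem θ) where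
  open IsTransitionSystem ts

  game : DecisionGame S
  game = record
    { E  = Σ (Subset S) λ X′ → Σ (Subset S) λ Y′ → θ X′ Y′
    ; e₀ = nonempty
    ; O  = λ { s (X′ , Y′ , _) t → X′ s × Y′ t }
    }

  θ⇒allows : ∀ {X Y} → θ X Y → Allows game X Y
  θ⇒allows {X} {Y} p = (X , Y , p) , λ s s∈X → outcome-nonempty s∈X , proj₂
    where
    -- If Y were empty, monotonicity would give (X, ∅) ∈ θ for the nonempty X.
    outcome-nonempty : ∀ {s} → X s → (λ t → X s × Y t) ≢∅
    outcome-nonempty {s} s∈X outcome-empty =
      nonTriviality (λ X-empty → X-empty s s∈X) (monotone p λ {t} t∈Y → outcome-empty t (s∈X , t∈Y))

  allows⇒θ : ExcludedMiddle 0ℓ → ∀ {X Y} → Allows game X Y → θ X Y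
  allows⇒θ em {X} {Y} ((X′ , Y′ , p) , h) with em {∃ X}
  ... | no X-empty = downwardClosed (nonCreation Y) λ {s} s∈X → ⊥-elim (X-empty (s , s∈X))
  ... | yes (s₀ , s₀∈X) = monotone (downwardClosed p X⊆X′) Y′⊆Y
    where
    -- A state outside X′ has no outcome under (X′, Y′), so it cannot lie in X.
    X⊆X′ : X ⊆ X′
    X⊆X′ {s} s∈X with em {X′ s}
    ... | yes s∈X′ = s∈X′
    ... | no s∉X′  = ⊥-elim (proj₁ (h s s∈X) λ _ o → s∉X′ (proj₁ o))

    Y′⊆Y : Y′ ⊆ Y
    Y′⊆Y t∈Y′ = proj₂ (h s₀ s₀∈X) (X⊆X′ s₀∈X , t∈Y′)

  represents : ExcludedMiddle 0ℓ → Represents game θ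
  represents em X Y = θ⇒allows , allows⇒θ em

mainTheorem1 : ExcludedMiddle 0ℓ →
    (S : Set) → S → (θ : Rel𝒫 S) →
    (IsTransitionSystem θ → Σ (DecisionGame S) λ Γ → ∀ X Y → (θ X Y → Allows Γ X Y) × (Allows Γ X Y → θ X Y))
    × ((Σ (DecisionGame S) λ Γ → ∀ X Y → (θ X Y → Allows Γ X Y) × (Allows Γ X Y → θ X Y)) → IsTransitionSystem θ)
mainTheorem1 em S _ θ =
    (λ ts → CanonicalGame.game ts , CanonicalGame.represents ts em)
  , λ (Γ , rep) → represented⇒isTransitionSystem Γ rep
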